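{- In IITT there is no expression $t$ such that $X{:}\mathsf{Set}_0\vdash t:X$, where $X{:}\mathsf{Set}_0$ is the context consisting of the single relevant binding of the variable $X$ with type $\mathsf{Set}_0$.
   Context: Irrelevant Intensional Type Theory (IITT) is defined as follows. Sorts are $\mathsf{Set}_k$ ($k\in\mathbb{N}$), with $\mathsf{Axiom}=\{(\mathsf{Set}_i,\mathsf{Set}_{i+1})\mid i\in\mathbb{N}\}$ and $\mathsf{Rule}=\{(\mathsf{Set}_i,\mathsf{Set}_j,\mathsf{Set}_{\max(i,j)})\mid i,j\in\mathbb{N}\}$. Annotations are $\star\in\{:,\div\}$ (relevant, irrelevant). Expressions: $t,u,T,U ::= s \mid (x\star U)\to^{s,s'}T \mid x \mid \lambda x\star U.\,t \mid t\star u$, where $(x\star U)\to^{s,s'}T$ is a relevant or irrelevant dependent function type annotated with the sort $s$ of its domain and $s'$ of its codomain, and $t\star u$ is relevant application (also written $t\,u$) or irrelevant application $t\div u$. Expressions are taken modulo $\alpha$-equivalence; $[u/x]t$ is capture-avoiding substitution. Contexts: $\Gamma ::= () \mid \Gamma.\,x\star T$ (variables distinct). Resurrection $\Gamma^{\oplus}$ replaces each binding $x\div T$ by $x:T$. Abbreviations: $\Gamma\vdash t\div T$ means $\Gamma^\oplus\vdash t:T$; $\Gamma\vdash t=t'\div T$ means $\Gamma\vdash t\div T$ and $\Gamma\vdash t'\div T$; $\Gamma\vdash T$ means $\Gamma\vdash T:s$ for some sort $s$; $\Gamma\vdash T=T'$ means $\Gamma\vdash T=T':s$ for some $s$. The judgements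 $\vdash\Gamma$, $\Gamma\vdash t:T$, $\Gamma\vdash t=t':T$ are defined mutually inductively by: (contexts) $\vdash()$; from $\vdash\Gamma$ and $\Gamma\vdash T$ infer $\vdash\Gamma.x\star T$. (typing) from $\vdash\Gamma$, $(s,s')\in\mathsf{Axiom}$ infer $\Gamma\vdash s:s'$; from $\Gamma\vdash U:s_1$, $\Gamma.x\star U\vdash T:s_2$, $(s_1,s_2,s_3)\in\mathsf{Rule}$ infer $\Gamma\vdash (x\star U)\to^{s_1,s_2}T:s_3$; from $\vdash\Gamma$ and $(x:U)\in\Gamma$ infer $\Gamma\vdash x:U$ (no variable rule for irrelevant bindings); from $\Gamma.x\star U\vdash t:T$ and $\Gamma\vdash (x\star U)\to^{s,s'}T$ infer $\Gamma\vdash \lambda x\star U.t:(x\star U)\to^{s,s'}T$; from $\Gamma\vdash t:(x\star U)\to^{s,s'}T$ and $\Gamma\vdash u\star U$ infer $\Gamma\vdash t\star u:[u/x]T$; from $\Gamma\vdash t:T$ and $\Gamma\vdash T=T'$ infer $\Gamma\vdash t:T'$. (equality) $\beta$: from $\Gamma.x\star U\vdash t:T$ and $\Gamma\vdash u\star U$ infer $\Gamma\vdash(\lambda x\star U.t)\star u=[u/x]t:[u/x]T$; $\eta$: from $\Gamma\vdash t:(x\star U)\to^{s,s'}T$ infer $\Gamma\vdash t=\lambda x\star U.(t\star x):(x\star U)\to^{s,s'}T$; reflexivity, symmetry, transitivity; from $\Gamma\vdash U=U':s_1$, $\Gamma.x\star U\vdash T=T':s_2$, $(s_1,s_2,s_3)\in\mathsf{Rule}$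 infer $\Gamma\vdash (x\star U)\to^{s_1,s_2}T=(x\star U')\to^{s_1,s_2}T':s_3$; from $\Gamma\vdash U=U':s_1$, $\Gamma.x\star U\vdash T:s_2$, $\Gamma.x\star U\vdash t=t':T$ infer $\Gamma\vdash\lambda x\star U.t=\lambda x\star U'.t':(x\star U)\to^{s_1,s_2}T$; from $\Gamma\vdash t=t':(x\star U)\to^{s,s'}T$ and $\Gamma\vdash u=u'\star U$ infer $\Gamma\vdash t\star u=t'\star u':[u/x]T$; from $\Gamma\vdash t=t':T$ and $\Gamma\vdash T=T'$ infer $\Gamma\vdash t=t':T'$. -}

module Defs where

open import Data.Nat using (ℕ; zero; suc; _⊔_)
open import Data.Fin using (Fin; zero; suc)
open import Data.Product using (Σ; _×_; _,_)

-- Syntax of IITT (well-scoped de Bruijn indices; this realises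
-- "expressions modulo α-equivalence").

data Ann : Set where
  rel : Ann   -- ":"  relevant
  irr : Ann   -- "÷"  irrelevant

-- Sorts are Set_k, represented by k : ℕ.
-- Tm n : expressions with n free variables.
data Tm (n : ℕ) : Set where
  sort : ℕ → Tm n
  pi   : Ann → ℕ → ℕ → Tm n → Tm (suc n) → Tm n   -- (x ⋆ U) →^{Set_i , Set_j} T
  var  : Fin n → Tm n
  lam  : Ann → Tm n → Tm (suc n) → Tm n
  app  : Ann → Tm n → Tm n → Tm n

liftRen : ∀ {m n} → (Fin m → Fin n) → Fin (suc m) → Fin (suc n)
liftRen ρ zero    = zero
liftRen ρ (suc x) = suc (ρ x)

ren : ∀ {m n} → (Fin m → Fin n) → Tm m → Tm n
ren ρ (sort k)        = sort k
ren ρ (pi a i j U T)  = pi a i j (ren ρ U) (ren (liftRen ρ) T)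
ren ρ (var x)         = var (ρ x)
ren ρ (lam a U t)     = lam a (ren ρ U) (ren (liftRen ρ) t)
ren ρ (app a t u)     = app a (ren ρ t) (ren ρ u)

wk : ∀ {n} → Tm n → Tm (suc n)
wk = ren suc

liftSub : ∀ {m n} → (Fin m → Tm n) → Fin (suc m) → Tm (suc n)
liftSub σ zero    = var zero
liftSub σ (suc x) = wk (σ x)

sub : ∀ {m n} → (Fin m → Tm n) → Tm m → Tm n
sub σ (sort k)        = sort k
sub σ (pi a i j U T)  = pi a i j (sub σ U) (sub (liftSub σ) T)
sub σ (var x)         = σ x
sub σ (lam a U t)     = lam a (sub σ U) (sub (liftSub σ) t)
sub σ (app a t u)     = app a (sub σ t) (sub σ u)

single : ∀ {n} → Tm n → Fin (suc n) → Tm n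
single u zero    = u
single u (suc x) = var x

_[_] : ∀ {n} → Tm (suc n) → Tm n → Tm n
t [ u ] = sub (single u) t

data Ctx : ℕ → Set where
  ε   : Ctx zero
  _▷_ : ∀ {n} → Ctx n → Ann × Tm n → Ctx (suc n)

_⊕ : ∀ {n} → Ctx n → Ctx n
ε ⊕             = ε
(Γ ▷ (a , T)) ⊕ = (Γ ⊕) ▷ (rel , T)

-- (x : U) ∈ Γ  (relevant bindings only), with the type weakened to Γ
data _∋_∶_ : ∀ {n} → Ctx n → Fin n → Tm n → Set where
  here  : ∀ {n} {Γ : Ctx n} {U : Tm n} →
          (Γ ▷ (rel , U)) ∋ zero ∶ wk U
  there : ∀ {n} {Γ : Ctx n} {x : Fin n} {U : Tm n} {b : Ann × Tm n} →
          Γ ∋ x ∶ U → (Γ ▷ b) ∋ suc x ∶ wk U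

data ⊢_ : ∀ {n} → Ctx n → Set
data _⊢_∶_ {n : ℕ} (Γ : Ctx n) : Tm n → Tm n → Set
data _⊢_≡_∶_ {n : ℕ} (Γ : Ctx n) : Tm n → Tm n → Tm n → Set
data _⊢_∷[_]_ {n : ℕ} (Γ : Ctx n) : Tm n → Ann → Tm n → Set
data _⊢_≡_∷[_]_ {n : ℕ} (Γ : Ctx n) : Tm n → Tm n → Ann → Tm n → Set

_⊢ty_ : ∀ {n} → Ctx n → Tm n → Set
Γ ⊢ty T = Σ ℕ (λ k → Γ ⊢ T ∶ sort k)

_⊢ty_≡_ : ∀ {n} → Ctx n → Tm n → Tm n → Set
Γ ⊢ty T ≡ T' = Σ ℕ (λ k → Γ ⊢ T ≡ T' ∶ sort k)

data ⊢_ where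
  ⊢ε : ⊢ ε
  ⊢▷ : ∀ {n} {Γ : Ctx n} {a : Ann} {T : Tm n} →
       ⊢ Γ → Σ ℕ (λ k → Γ ⊢ T ∶ sort k) → ⊢ (Γ ▷ (a , T))

data _⊢_∷[_]_ {n} Γ where
  ∷rel : ∀ {t T} → Γ ⊢ t ∶ T → Γ ⊢ t ∷[ rel ] T
  ∷irr : ∀ {t T} → (Γ ⊕) ⊢ t ∶ T → Γ ⊢ t ∷[ irr ] T

data _⊢_≡_∷[_]_ {n} Γ where
  ≡rel : ∀ {t t' T} → Γ ⊢ t ≡ t' ∶ T → Γ ⊢ t ≡ t' ∷[ rel ] T
  ≡irr : ∀ {t t' T} → (Γ ⊕) ⊢ t ∶ T → (Γ ⊕) ⊢ t' ∶ T →
         Γ ⊢ t ≡ t' ∷[ irr ] T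

data _⊢_∶_ {n} Γ where
  t-sort : ∀ {i} → ⊢ Γ → Γ ⊢ sort i ∶ sort (suc i)
  t-pi   : ∀ {a i j U T} →
           Γ ⊢ U ∶ sort i → (Γ ▷ (a , U)) ⊢ T ∶ sort j →
           Γ ⊢ pi a i j U T ∶ sort (i ⊔ j)
  t-var  : ∀ {x U} → ⊢ Γ → Γ ∋ x ∶ U → Γ ⊢ var x ∶ U
  t-lam  : ∀ {a i j U T t} →
           (Γ ▷ (a , U)) ⊢ t ∶ T →
           Σ ℕ (λ k → Γ ⊢ pi a i j U T ∶ sort k) →
           Γ ⊢ lam a U t ∶ pi a i j U T
  t-app  : ∀ {a i j U T t u} →
           Γ ⊢ t ∶ pi a i j U T → Γ ⊢ u ∷[ a ] U →
           Γ ⊢ app a t u ∶ (T [ u ])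
  t-conv : ∀ {t T T'} →
           Γ ⊢ t ∶ T → Σ ℕ (λ k → Γ ⊢ T ≡ T' ∶ sort k) → Γ ⊢ t ∶ T'

data _⊢_≡_∶_ {n} Γ where
  e-β     : ∀ {a U T t u} →
            (Γ ▷ (a , U)) ⊢ t ∶ T → Γ ⊢ u ∷[ a ] U →
            Γ ⊢ app a (lam a U t) u ≡ (t [ u ]) ∶ (T [ u ])
  e-η     : ∀ {a i j U T t} →
            Γ ⊢ t ∶ pi a i j U T →
            Γ ⊢ t ≡ lam a U (app a (wk t) (var zero)) ∶ pi a i j U T
  e-refl  : ∀ {t T} → Γ ⊢ t ∶ T → Γ ⊢ t ≡ t ∶ T
  e-sym   : ∀ {t t' T} → Γ ⊢ t ≡ t' ∶ T → Γ ⊢ t' ≡ t ∶ T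
  e-trans : ∀ {t t' t'' T} →
            Γ ⊢ t ≡ t' ∶ T → Γ ⊢ t' ≡ t'' ∶ T → Γ ⊢ t ≡ t'' ∶ T
  e-pi    : ∀ {a i j U U' T T'} →
            Γ ⊢ U ≡ U' ∶ sort i → (Γ ▷ (a , U)) ⊢ T ≡ T' ∶ sort j →
            Γ ⊢ pi a i j U T ≡ pi a i j U' T' ∶ sort (i ⊔ j)
  e-lam   : ∀ {a i j U U' T t t'} →
            Γ ⊢ U ≡ U' ∶ sort i → (Γ ▷ (a , U)) ⊢ T ∶ sort j →
            (Γ ▷ (a , U)) ⊢ t ≡ t' ∶ T →
            Γ ⊢ lam a U t ≡ lam a U' t' ∶ pi a i j U T
  e-app   : ∀ {a i j U T t t' u u'} →
            Γ ⊢ t ≡ t' ∶ pi a i j U T → Γ ⊢ u ≡ u' ∷[ a ] U →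
            Γ ⊢ app a t u ≡ app a t' u' ∶ (T [ u ])
  e-conv  : ∀ {t t' T T'} →
            Γ ⊢ t ≡ t' ∶ T → Σ ℕ (λ k → Γ ⊢ T ≡ T' ∶ sort k) →
            Γ ⊢ t ≡ t' ∶ T'

X∶Set₀ : Ctx 1
X∶Set₀ = ε ▷ (rel , sort 0)

-- IITT has a model in well-founded Aczel-style sets.  Types denote sets, terms
-- elements, functions their graphs, and Π-types the graphs of dependent functions;
-- an irrelevant Π only contains functions that are constant on their domain.
-- Judgements are interpreted relative to a partial equivalence on environments
-- that ignores the values of irrelevant variables, which validates the rule
-- t ÷ u = t' ÷ u'.  Each Set_k is a universe of codes built over the one below,
-- so Set₀ contains the code of the universe below level 0, which is empty.
-- Interpreting X as that empty set, a derivation of X : Set₀ ⊢ t : X would give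
-- an element of the empty set.

module Submission where

open import Defs
open import Data.Nat using (ℕ; zero; suc; _⊔_; _≤′_; ≤′-refl; ≤′-step)
open import Data.Nat.Properties using (m≤m⊔n; m≤n⊔m; ≤⇒≤′)
open import Data.Fin using (Fin; zero; suc)
open import Data.Product using (Σ; _×_; _,_; proj₁; proj₂)
open import Data.Empty using (⊥)
open import Data.Unit using (⊤; tt)
open import Function using (_∘_)
open import Level using (0ℓ) renaming (suc to ℓsuc)
open import Relation.Binary.Bundles using (Setoid)
open import Relation.Nullary using (¬_)

-- node I k v is the family of pairs (k i , v i); as a set its elements are the
-- keys k i, and a function is represented by its graph.
data V : Set₁ where
  node : (I : Set) → (I → V) → (I → V) → V

Ix : V → Set
Ix (node I k v) = I

key : (x : V) → Ix x → V
key (node I k v) = k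

val : (x : V) → Ix x → V
val (node I k v) = v

infix 4 _≈_ _∈_

_≈_ : V → V → Set
node I k v ≈ node J k' v' =
  ((i : I) → Σ J λ j → (k i ≈ k' j) × (v i ≈ v' j)) ×
  ((j : J) → Σ I λ i → (k i ≈ k' j) × (v i ≈ v' j))

≈-refl : ∀ {x} → x ≈ x
≈-refl {node I k v} = (λ i → i , ≈-refl , ≈-refl) , (λ i → i , ≈-refl , ≈-refl)

≈-sym : ∀ {x y} → x ≈ y → y ≈ x
≈-sym {node I k v} {node J k' v'} (forth , back) =
  (λ j → let (i , p , q) = back j in i , ≈-sym p , ≈-sym q) ,
  (λ i → let (j , p , q) = forth i in j , ≈-sym p , ≈-sym q)

≈-trans : ∀ {x y z} → x ≈ y → y ≈ z → x ≈ z
≈-trans {node I k v} {node J k' v'} {node K k'' v''} (forth , back) (forth' , back') =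
  (λ i → let (j , p , q) = forth i ; (l , p' , q') = forth' j
         in l , ≈-trans p p' , ≈-trans q q') ,
  (λ l → let (j , p' , q') = back' l ; (i , p , q) = back j
         in i , ≈-trans p p' , ≈-trans q q')

≈-setoid : Setoid (ℓsuc 0ℓ) 0ℓ
≈-setoid = record
  { Carrier = V
  ; _≈_ = _≈_
  ; isEquivalence = record { refl = ≈-refl ; sym = ≈-sym ; trans = ≈-trans }
  }

open import Relation.Binary.Reasoning.Setoid ≈-setoid

Forth : (x y : V) → Set
Forth x y = (i : Ix x) → Σ (Ix y) λ j → (key x i ≈ key y j) × (val x i ≈ val y j)

Back : (x y : V) → Set
Back x y = (j : Ix y) → Σ (Ix x) λ i → (key x i ≈ key y j) × (val x i ≈ val y j)

≈-forth : ∀ {x y} → x ≈ y → Forth x y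
≈-forth {node I k v} {node J k' v'} = proj₁

≈-back : ∀ {x y} → x ≈ y → Back x y
≈-back {node I k v} {node J k' v'} = proj₂

≈-intro : ∀ {x y} → Forth x y → Back x y → x ≈ y
≈-intro {node I k v} {node J k' v'} = _,_

record _∈_ (x A : V) : Set where
  constructor _,_
  field
    index : Ix A
    key≈  : key A index ≈ x

open _∈_

∈-respʳ-≈ : ∀ {x A A'} → A ≈ A' → x ∈ A → x ∈ A'
∈-respʳ-≈ A≈A' (i , p) = let (j , q , _) = ≈-forth A≈A' i in j , ≈-trans (≈-sym q) p

∈-respˡ-≈ : ∀ {x y A} → x ≈ y → x ∈ A → y ∈ A
∈-respˡ-≈ x≈y (i , p) = i , ≈-trans p x≈y

∅ : V
∅ = node ⊥ (λ ()) (λ ())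

Lam : V → (V → V) → V
Lam A F = node (Ix A) (key A) (λ i → F (key A i))

-- F · x is the union of all values that F pairs with keys equal to x.
_·_ : V → V → V
node I k v · x =
  node (Σ I λ i → (k i ≈ x) × Ix (v i))
       (λ (i , _ , j) → key (v i) j)
       (λ (i , _ , j) → val (v i) j)

Lam-cong : ∀ {A A'} (F F' : V → V) → A ≈ A' →
  (∀ i j → key A i ≈ key A' j → F (key A i) ≈ F' (key A' j)) → Lam A F ≈ Lam A' F'
Lam-cong F F' A≈A' F≈F' =
  (λ i → let (j , p , _) = ≈-forth A≈A' i in j , p , F≈F' i j p) ,
  (λ j → let (i , p , _) = ≈-back A≈A' j in i , p , F≈F' i j p)

·-cong : ∀ {F F' x x'} → F ≈ F' → x ≈ x' → F · x ≈ F' · x'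
·-cong {node I k v} {node I' k' v'} (forth , back) x≈x' =
  (λ (i , p , l) → let (i' , q , r) = forth i ; (l' , s , t) = ≈-forth r l
                   in (i' , ≈-trans (≈-sym q) (≈-trans p x≈x') , l') , s , t) ,
  (λ (i' , p , l') → let (i , q , r) = back i' ; (l , s , t) = ≈-back r l'
                     in (i , ≈-trans q (≈-trans p (≈-sym x≈x')) , l) , s , t)

·-functional : ∀ I k v → (∀ i j → k i ≈ k j → v i ≈ v j) →
  ∀ {x} i → x ≈ k i → node I k v · x ≈ v i
·-functional I k v functional i x≈ki = ≈-intro
  (λ (j , p , l) → ≈-forth (functional j i (≈-trans p x≈ki)) l)
  (λ l → (i , ≈-sym x≈ki , l) , ≈-refl , ≈-refl)

Lam-β : ∀ {A x} (F : V → V) → (∀ {v w} → v ≈ w → F v ≈ F w) → x ∈ A → Lam A F · x ≈ F x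
Lam-β {A} F F-cong (i , ki≈x) =
  ≈-trans (·-functional (Ix A) (key A) (F ∘ key A) (λ _ _ → F-cong) i (≈-sym ki≈x))
          (F-cong ki≈x)

Agree : Ann → V → V → Set
Agree rel x y = x ≈ y
Agree irr x y = ⊤

agree : ∀ a {x y} → x ≈ y → Agree a x y
agree rel x≈y = x≈y
agree irr _   = tt

Agree-sym : ∀ a {x y} → Agree a x y → Agree a y x
Agree-sym rel = ≈-sym
Agree-sym irr _ = tt

Agree-resp-≈ : ∀ a {x x' y y'} → x ≈ x' → y ≈ y' → Agree a x y → Agree a x' y'
Agree-resp-≈ rel x≈x' y≈y' x≈y = ≈-trans (≈-sym x≈x') (≈-trans x≈y y≈y')
Agree-resp-≈ irr _ _ _ = tt

-- For a = irr this forces the function to be constant.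
DepFun : Ann → (A : V) → (Ix A → V) → Set
DepFun a A B = Σ ((i : Ix A) → Ix (B i)) λ f →
  ∀ i j → Agree a (key A i) (key A j) → key (B i) (f i) ≈ key (B j) (f j)

DepFun-functional : ∀ a A B (p : DepFun a A B) i j → key A i ≈ key A j →
  key (B i) (proj₁ p i) ≈ key (B j) (proj₁ p j)
DepFun-functional a A B (f , f-resp) i j ki≈kj = f-resp i j (agree a ki≈kj)

graph : (A : V) (B : Ix A → V) → ((i : Ix A) → Ix (B i)) → V
graph A B f = node (Ix A) (key A) (λ i → key (B i) (f i))

·-graph : ∀ a A B (p : DepFun a A B) {x} i → x ≈ key A i →
  graph A B (proj₁ p) · x ≈ key (B i) (proj₁ p i)
·-graph a A B p = ·-functional (Ix A) (key A) (λ i → key (B i) (proj₁ p i))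
  (DepFun-functional a A B p)

DepFun-transport : ∀ a {A A'} (B : Ix A → V) (B' : Ix A' → V) → A ≈ A' →
  (∀ i j → key A i ≈ key A' j → B i ≈ B' j) →
  (p : DepFun a A B) → Σ (DepFun a A' B') λ q → graph A B (proj₁ p) ≈ graph A' B' (proj₁ q)
DepFun-transport a {A} {A'} B B' A≈A' B≈B' (f , f-resp) =
  (g , g-resp) , ≈-intro forth back
  where
  pull : Ix A' → Ix A
  pull j = proj₁ (≈-back A≈A' j)

  key-pull : ∀ j → key A (pull j) ≈ key A' j
  key-pull j = proj₁ (proj₂ (≈-back A≈A' j))

  moved : ∀ j → key (B (pull j)) (f (pull j)) ∈ B' j
  moved j = ∈-respʳ-≈ (B≈B' (pull j) j (key-pull j)) (f (pull j) , ≈-refl)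

  g : (j : Ix A') → Ix (B' j)
  g j = index (moved j)

  key-g : ∀ j → key (B' j) (g j) ≈ key (B (pull j)) (f (pull j))
  key-g j = key≈ (moved j)

  g-resp : ∀ j j' → Agree a (key A' j) (key A' j') → key (B' j) (g j) ≈ key (B' j') (g j')
  g-resp j j' agr = begin
    key (B' j) (g j)                 ≈⟨ key-g j ⟩
    key (B (pull j)) (f (pull j))    ≈⟨ f-resp (pull j) (pull j')
                                          (Agree-resp-≈ a (≈-sym (key-pull j)) (≈-sym (key-pull j')) agr) ⟩
    key (B (pull j')) (f (pull j'))  ≈⟨ ≈-sym (key-g j') ⟩
    key (B' j') (g j')               ∎

  forth : Forth (graph A B f) (graph A' B' g)
  forth i = let (j , ki≈kj , _) = ≈-forth A≈A' i in
    j , ki≈kj ,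
    ≈-trans (DepFun-functional a A B (f , f-resp) i (pull j) (≈-trans ki≈kj (≈-sym (key-pull j))))
            (≈-sym (key-g j))

  back : Back (graph A B f) (graph A' B' g)
  back j = pull j , key-pull j , ≈-sym (key-g j)

-- The values of Pi are irrelevant; only its keys, the graphs, matter.
Pi : Ann → (A : V) → (Ix A → V) → V
Pi a A B = node (DepFun a A B) (λ p → graph A B (proj₁ p)) (λ _ → ∅)

Pi-cong : ∀ a {A A'} (B : Ix A → V) (B' : Ix A' → V) → A ≈ A' →
  (∀ i j → key A i ≈ key A' j → B i ≈ B' j) → Pi a A B ≈ Pi a A' B'
Pi-cong a B B' A≈A' B≈B' =
  (λ p → let (q , p≈q) = DepFun-transport a B B' A≈A' B≈B' p in q , p≈q , ≈-refl) ,
  (λ q → let (p , q≈p) = DepFun-transport a B' B (≈-sym A≈A')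
                           (λ j i kj≈ki → ≈-sym (B≈B' i j (≈-sym kj≈ki))) q
         in p , ≈-sym q≈p , ≈-refl)

Lam-∈-Pi : ∀ a A (F : V → V) (B : Ix A → V) → (∀ i → F (key A i) ∈ B i) →
  (∀ i j → Agree a (key A i) (key A j) → F (key A i) ≈ F (key A j)) → Lam A F ∈ Pi a A B
Lam-∈-Pi a A F B F∈B F-resp =
  (f , f-resp) , (λ i → i , ≈-refl , key-f i) , (λ i → i , ≈-refl , key-f i)
  where
  f : (i : Ix A) → Ix (B i)
  f i = index (F∈B i)

  key-f : ∀ i → key (B i) (f i) ≈ F (key A i)
  key-f i = key≈ (F∈B i)

  f-resp : ∀ i j → Agree a (key A i) (key A j) → key (B i) (f i) ≈ key (B j) (f j)
  f-resp i j agr = ≈-trans (key-f i) (≈-trans (F-resp i j agr) (≈-sym (key-f j)))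

·-Pi : ∀ a A B {F x} ((p , _) : F ∈ Pi a A B) i → key A i ≈ x → F · x ≈ key (B i) (proj₁ p i)
·-Pi a A B (p , p≈F) i ki≈x = ≈-trans (·-cong (≈-sym p≈F) ≈-refl) (·-graph a A B p i (≈-sym ki≈x))

·-∈-Pi : ∀ a A B {F x} → F ∈ Pi a A B → x ∈ A → Σ (Ix A) λ i → (key A i ≈ x) × (F · x ∈ B i)
·-∈-Pi a A B F∈@(p , _) (i , ki≈x) = i , ki≈x , (proj₁ p i , ≈-sym (·-Pi a A B F∈ i ki≈x))

Pi-η : ∀ a A B {F} → F ∈ Pi a A B → F ≈ Lam A (F ·_)
Pi-η a A B {F} F∈@(p , p≈F) =
  ≈-trans (≈-sym p≈F) ((λ i → i , ≈-refl , value i) , (λ i → i , ≈-refl , value i))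
  where
  value : ∀ i → key (B i) (proj₁ p i) ≈ F · key A i
  value i = ≈-sym (·-Pi a A B F∈ i ≈-refl)

record ArgRel (a : Ann) (A A' x x' : V) : Set where
  constructor related
  field
    ∈ˡ    : x ∈ A
    ∈ʳ    : x' ∈ A'
    agrees : Agree a x x'

open ArgRel

ArgRel-sym : ∀ {a A A' x x'} → ArgRel a A A' x x' → ArgRel a A' A x' x
ArgRel-sym {a} (related x∈ x'∈ agr) = related x'∈ x∈ (Agree-sym a agr)

ArgRel-reflˡ : ∀ {a A A' x x'} → ArgRel a A A' x x' → ArgRel a A A x x
ArgRel-reflˡ {a} (related x∈ _ _) = related x∈ x∈ (agree a ≈-refl)

ArgRel-resp-≈ : ∀ {a A A' B B' x x'} → A ≈ B → A' ≈ B' → ArgRel a A A' x x' → ArgRel a B B' x x'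
ArgRel-resp-≈ A≈B A'≈B' (related x∈ x'∈ agr) = related (∈-respʳ-≈ A≈B x∈) (∈-respʳ-≈ A'≈B' x'∈) agr

-- An irrelevant application needs no agreement of the arguments: both sides are
-- the constant value of the function.
·-cong-Pi : ∀ a A B A' B' {F F' x x'} → F ∈ Pi a A B → F' ∈ Pi a A' B' → F ≈ F' →
  ArgRel a A A' x x' → F · x ≈ F' · x'
·-cong-Pi rel A B A' B' _ _ F≈F' (related _ _ x≈x') = ·-cong F≈F' x≈x'
·-cong-Pi irr A B A' B' {F} {F'} {x} {x'} F∈@((f , f-const) , p≈F) F'∈@((g , _) , q≈F')
  F≈F' (related (i , ki≈x) (j , kj≈x') _) = begin
    F · x               ≈⟨ ·-Pi irr A B F∈ i ki≈x ⟩
    key (B i) (f i)     ≈⟨ f-const i i' tt ⟩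
    key (B i') (f i')   ≈⟨ proj₂ (proj₂ (≈-back graphs≈ j)) ⟩
    key (B' j) (g j)    ≈⟨ ≈-sym (·-Pi irr A' B' F'∈ j kj≈x') ⟩
    F' · x'             ∎
  where
  graphs≈ : graph A B f ≈ graph A' B' g
  graphs≈ = ≈-trans p≈F (≈-trans F≈F' (≈-sym q≈F'))

  i' : Ix A
  i' = proj₁ (≈-back graphs≈ j)

-- The universe of codes over a lower universe of codes; univ is the code of the
-- lower universe itself.
module Universe (Lower : Set) (El-lower : Lower → V) where
  data Code : Set
  El : Code → V

  data Code where
    lift : Lower → Code
    univ : Code
    π    : Ann → (c : Code) → (Ix (El c) → Code) → Code

  El (lift c)  = El-lower c
  El univ      = node Lower El-lower (λ _ → ∅)
  El (π a c d) = Pi a (El c) (El ∘ d)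

Below : ℕ → Σ Set λ C → C → V
Below zero    = ⊥ , λ ()
Below (suc k) = Universe.Code (proj₁ (Below k)) (proj₂ (Below k)) ,
                Universe.El (proj₁ (Below k)) (proj₂ (Below k))

module Lvl (k : ℕ) = Universe (proj₁ (Below k)) (proj₂ (Below k))

Sort : ℕ → V
Sort k = node (Lvl.Code k) (Lvl.El k) (λ _ → ∅)

∈-Sort-≤′ : ∀ {i k x} → i ≤′ k → x ∈ Sort i → x ∈ Sort k
∈-Sort-≤′ ≤′-refl      x∈ = x∈
∈-Sort-≤′ {k = suc k} (≤′-step i≤k) x∈ =
  let (c , c≈x) = ∈-Sort-≤′ i≤k x∈ in Lvl.lift {suc k} c , c≈x

Pi-∈-Sort : ∀ k a A (B : Ix A → V) → A ∈ Sort k → (∀ i → B i ∈ Sort k) →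
  (∀ i j → key A i ≈ key A j → B i ≈ B j) → Pi a A B ∈ Sort k
Pi-∈-Sort k a A B (c , c≈A) B∈ B-resp =
  Lvl.π {k} a c d ,
  Pi-cong a (Lvl.El k ∘ d) B c≈A
    (λ l i kl≈ki → ≈-trans (key≈ (B∈ (push l))) (B-resp (push l) i (≈-trans (≈-sym (key-push l)) kl≈ki)))
  where
  push : Ix (Lvl.El k c) → Ix A
  push l = proj₁ (≈-forth c≈A l)

  key-push : ∀ l → key (Lvl.El k c) l ≈ key A (push l)
  key-push l = proj₁ (proj₂ (≈-forth c≈A l))

  d : Ix (Lvl.El k c) → Lvl.Code k
  d l = index (B∈ (push l))

Pi-∈-Sort-⊔ : ∀ k l a A (B : Ix A → V) → A ∈ Sort k → (∀ i → B i ∈ Sort l) →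
  (∀ i j → key A i ≈ key A j → B i ≈ B j) → Pi a A B ∈ Sort (k ⊔ l)
Pi-∈-Sort-⊔ k l a A B A∈ B∈ = Pi-∈-Sort (k ⊔ l) a A B
  (∈-Sort-≤′ (≤⇒≤′ (m≤m⊔n k l)) A∈) (λ i → ∈-Sort-≤′ (≤⇒≤′ (m≤n⊔m k l)) (B∈ i))

Env : ℕ → Set₁
Env n = Fin n → V

_,,_ : ∀ {n} → Env n → V → Env (suc n)
(γ ,, v) zero    = v
(γ ,, v) (suc x) = γ x

⟦_⟧ : ∀ {n} → Tm n → Env n → V
⟦_⟧⁺ : ∀ {n} → Tm (suc n) → Env n → (A : V) → Ix A → V

⟦ sort k ⟧       γ = Sort k
⟦ pi a _ _ U T ⟧ γ = Pi a (⟦ U ⟧ γ) (⟦ T ⟧⁺ γ (⟦ U ⟧ γ))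
⟦ var x ⟧        γ = γ x
⟦ lam a U t ⟧    γ = Lam (⟦ U ⟧ γ) (λ v → ⟦ t ⟧ (γ ,, v))
⟦ app a t u ⟧    γ = ⟦ t ⟧ γ · ⟦ u ⟧ γ

⟦ T ⟧⁺ γ A i = ⟦ T ⟧ (γ ,, key A i)

⟦⟧-cong : ∀ {n} (t : Tm n) {γ δ : Env n} → (∀ x → γ x ≈ δ x) → ⟦ t ⟧ γ ≈ ⟦ t ⟧ δ
⟦⟧-cong (sort k)       γ≈δ = ≈-refl
⟦⟧-cong (pi a _ _ U T) γ≈δ = Pi-cong a _ _ (⟦⟧-cong U γ≈δ)
  (λ _ _ v≈w → ⟦⟧-cong T λ { zero → v≈w ; (suc x) → γ≈δ x })
⟦⟧-cong (var x)        γ≈δ = γ≈δ x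
⟦⟧-cong (lam a U t) {γ} {δ} γ≈δ =
  Lam-cong (λ v → ⟦ t ⟧ (γ ,, v)) (λ v → ⟦ t ⟧ (δ ,, v)) (⟦⟧-cong U γ≈δ)
  (λ _ _ v≈w → ⟦⟧-cong t λ { zero → v≈w ; (suc x) → γ≈δ x })
⟦⟧-cong (app a t u)    γ≈δ = ·-cong (⟦⟧-cong t γ≈δ) (⟦⟧-cong u γ≈δ)

⟦⟧-cong₀ : ∀ {n} (t : Tm (suc n)) {γ : Env n} {v w} → v ≈ w → ⟦ t ⟧ (γ ,, v) ≈ ⟦ t ⟧ (γ ,, w)
⟦⟧-cong₀ t v≈w = ⟦⟧-cong t λ { zero → v≈w ; (suc x) → ≈-refl }

⟦ren⟧ : ∀ {m n} (ρ : Fin m → Fin n) (t : Tm m) {γ : Env n} {δ : Env m} →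
  (∀ x → γ (ρ x) ≈ δ x) → ⟦ ren ρ t ⟧ γ ≈ ⟦ t ⟧ δ
⟦ren⟧ ρ (sort k)       γρ≈δ = ≈-refl
⟦ren⟧ ρ (pi a _ _ U T) γρ≈δ = Pi-cong a _ _ (⟦ren⟧ ρ U γρ≈δ)
  (λ _ _ v≈w → ⟦ren⟧ (liftRen ρ) T λ { zero → v≈w ; (suc x) → γρ≈δ x })
⟦ren⟧ ρ (var x)        γρ≈δ = γρ≈δ x
⟦ren⟧ ρ (lam a U t) {γ} {δ} γρ≈δ =
  Lam-cong (λ v → ⟦ ren (liftRen ρ) t ⟧ (γ ,, v)) (λ v → ⟦ t ⟧ (δ ,, v)) (⟦ren⟧ ρ U γρ≈δ)
  (λ _ _ v≈w → ⟦ren⟧ (liftRen ρ) t λ { zero → v≈w ; (suc x) → γρ≈δ x })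
⟦ren⟧ ρ (app a t u)    γρ≈δ = ·-cong (⟦ren⟧ ρ t γρ≈δ) (⟦ren⟧ ρ u γρ≈δ)

⟦wk⟧ : ∀ {n} (t : Tm n) {γ : Env (suc n)} → ⟦ wk t ⟧ γ ≈ ⟦ t ⟧ (γ ∘ suc)
⟦wk⟧ t = ⟦ren⟧ suc t λ _ → ≈-refl

⟦sub⟧ : ∀ {m n} (σ : Fin m → Tm n) (t : Tm m) {γ : Env n} {δ : Env m} →
  (∀ x → ⟦ σ x ⟧ γ ≈ δ x) → ⟦ sub σ t ⟧ γ ≈ ⟦ t ⟧ δ
⟦sub⟧ σ (sort k)       γσ≈δ = ≈-refl
⟦sub⟧ σ (pi a _ _ U T) γσ≈δ = Pi-cong a _ _ (⟦sub⟧ σ U γσ≈δ)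
  (λ _ _ v≈w → ⟦sub⟧ (liftSub σ) T λ { zero → v≈w ; (suc x) → ≈-trans (⟦wk⟧ (σ x)) (γσ≈δ x) })
⟦sub⟧ σ (var x)        γσ≈δ = γσ≈δ x
⟦sub⟧ σ (lam a U t) {γ} {δ} γσ≈δ =
  Lam-cong (λ v → ⟦ sub (liftSub σ) t ⟧ (γ ,, v)) (λ v → ⟦ t ⟧ (δ ,, v)) (⟦sub⟧ σ U γσ≈δ)
  (λ _ _ v≈w → ⟦sub⟧ (liftSub σ) t λ { zero → v≈w ; (suc x) → ≈-trans (⟦wk⟧ (σ x)) (γσ≈δ x) })
⟦sub⟧ σ (app a t u)    γσ≈δ = ·-cong (⟦sub⟧ σ t γσ≈δ) (⟦sub⟧ σ u γσ≈δ)

⟦[]⟧ : ∀ {n} (t : Tm (suc n)) (u : Tm n) {γ : Env n} → ⟦ t [ u ] ⟧ γ ≈ ⟦ t ⟧ (γ ,, ⟦ u ⟧ γ)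
⟦[]⟧ t u = ⟦sub⟧ (single u) t λ { zero → ≈-refl ; (suc x) → ≈-refl }

-- Related environments agree on the relevant variables only.
EnvRel : ∀ {n} → Ctx n → Env n → Env n → Set
EnvRel ε             γ γ' = ⊤
EnvRel (Γ ▷ (a , T)) γ γ' =
  EnvRel Γ (γ ∘ suc) (γ' ∘ suc) ×
  ArgRel a (⟦ T ⟧ (γ ∘ suc)) (⟦ T ⟧ (γ' ∘ suc)) (γ zero) (γ' zero)

EnvRel-sym : ∀ {n} (Γ : Ctx n) {γ γ'} → EnvRel Γ γ γ' → EnvRel Γ γ' γ
EnvRel-sym ε             _       = tt
EnvRel-sym (Γ ▷ (a , T)) (r , x) = EnvRel-sym Γ r , ArgRel-sym x

EnvRel-reflˡ : ∀ {n} (Γ : Ctx n) {γ γ'} → EnvRel Γ γ γ' → EnvRel Γ γ γ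
EnvRel-reflˡ ε             _       = tt
EnvRel-reflˡ (Γ ▷ (a , T)) (r , x) = EnvRel-reflˡ Γ r , ArgRel-reflˡ x

EnvRel-reflʳ : ∀ {n} (Γ : Ctx n) {γ γ'} → EnvRel Γ γ γ' → EnvRel Γ γ' γ'
EnvRel-reflʳ Γ r = EnvRel-reflˡ Γ (EnvRel-sym Γ r)

EnvRel-⊕ : ∀ {n} (Γ : Ctx n) {γ} → EnvRel Γ γ γ → EnvRel (Γ ⊕) γ γ
EnvRel-⊕ ε             _                    = tt
EnvRel-⊕ (Γ ▷ (a , T)) (r , related x∈ _ _) = EnvRel-⊕ Γ r , related x∈ x∈ ≈-refl

∋⇒ArgRel : ∀ {n} {Γ : Ctx n} {x U} → Γ ∋ x ∶ U →
  ∀ {γ γ'} → EnvRel Γ γ γ' → ArgRel rel (⟦ U ⟧ γ) (⟦ U ⟧ γ') (γ x) (γ' x)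
∋⇒ArgRel (here {U = U})       (_ , x) = ArgRel-resp-≈ (≈-sym (⟦wk⟧ U)) (≈-sym (⟦wk⟧ U)) x
∋⇒ArgRel (there {U = U} x∈Γ) (r , _) = ArgRel-resp-≈ (≈-sym (⟦wk⟧ U)) (≈-sym (⟦wk⟧ U)) (∋⇒ArgRel x∈Γ r)

record _⊨_≡_∶_ {n} (Γ : Ctx n) (t t' T : Tm n) : Set₁ where
  field
    ≈ᵛ : ∀ γ γ' → EnvRel Γ γ γ' → ⟦ t ⟧ γ ≈ ⟦ t' ⟧ γ'
    ∈ᵛ : ∀ γ → EnvRel Γ γ γ → ⟦ t ⟧ γ ∈ ⟦ T ⟧ γ

open _⊨_≡_∶_

record _⊨_≡_∷[_]_ {n} (Γ : Ctx n) (u u' : Tm n) (a : Ann) (U : Tm n) : Set₁ where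
  field
    argᵛ : ∀ γ γ' → EnvRel Γ γ γ' → ArgRel a (⟦ U ⟧ γ) (⟦ U ⟧ γ') (⟦ u ⟧ γ) (⟦ u' ⟧ γ')

open _⊨_≡_∷[_]_

∈ᵛʳ : ∀ {n} {Γ : Ctx n} {t t' T} → Γ ⊨ t ≡ t' ∶ T → ∀ γ → EnvRel Γ γ γ → ⟦ t' ⟧ γ ∈ ⟦ T ⟧ γ
∈ᵛʳ ⊨t γ r = ∈-respˡ-≈ (≈ᵛ ⊨t γ γ r) (∈ᵛ ⊨t γ r)

≈ᵛ-self : ∀ {n} {Γ : Ctx n} {t t' T} → Γ ⊨ t ≡ t' ∶ T → ∀ γ γ' → EnvRel Γ γ γ' → ⟦ t ⟧ γ ≈ ⟦ t ⟧ γ'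
≈ᵛ-self {Γ = Γ} ⊨t γ γ' r = ≈-trans (≈ᵛ ⊨t γ γ' r) (≈-sym (≈ᵛ ⊨t γ' γ' (EnvRel-reflʳ Γ r)))

module _ {n} {Γ : Ctx n} where

  EnvRel-▷ : ∀ {a U U' i} → Γ ⊨ U ≡ U' ∶ sort i → ∀ {γ γ'} → EnvRel Γ γ γ' → ∀ k l →
    Agree a (key (⟦ U ⟧ γ) k) (key (⟦ U' ⟧ γ') l) →
    EnvRel (Γ ▷ (a , U)) (γ ,, key (⟦ U ⟧ γ) k) (γ' ,, key (⟦ U' ⟧ γ') l)
  EnvRel-▷ ⊨U {γ} {γ'} r k l agr =
    r , related (k , ≈-refl) (∈-respʳ-≈ (≈-sym (≈ᵛ ⊨U γ' γ' (EnvRel-reflʳ Γ r))) (l , ≈-refl)) agr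

  ⊨-sort : ∀ {i} → Γ ⊨ sort i ≡ sort i ∶ sort (suc i)
  ≈ᵛ ⊨-sort _ _ _ = ≈-refl
  ∈ᵛ (⊨-sort {i}) _ _ = Lvl.univ {suc i} , ≈-refl

  ⊨-var : ∀ {x U} → Γ ∋ x ∶ U → Γ ⊨ var x ≡ var x ∶ U
  ≈ᵛ (⊨-var x∈Γ) _ _ r = agrees (∋⇒ArgRel x∈Γ r)
  ∈ᵛ (⊨-var x∈Γ) _ r   = ∈ˡ (∋⇒ArgRel x∈Γ r)

  ⊨-pi : ∀ {a i j U U' T T'} → Γ ⊨ U ≡ U' ∶ sort i → (Γ ▷ (a , U)) ⊨ T ≡ T' ∶ sort j →
    Γ ⊨ pi a i j U T ≡ pi a i j U' T' ∶ sort (i ⊔ j)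
  ≈ᵛ (⊨-pi {a} ⊨U ⊨T) γ γ' r = Pi-cong a _ _ (≈ᵛ ⊨U γ γ' r)
    (λ k l kk≈kl → ≈ᵛ ⊨T (γ ,, _) (γ' ,, _) (EnvRel-▷ ⊨U r k l (agree a kk≈kl)))
  ∈ᵛ (⊨-pi {a} {i} {j} ⊨U ⊨T) γ r = Pi-∈-Sort-⊔ i j a _ _ (∈ᵛ ⊨U γ r)
    (λ k → ∈ᵛ ⊨T (γ ,, _) (r , related (k , ≈-refl) (k , ≈-refl) (agree a ≈-refl)))
    (λ k l kk≈kl → ≈ᵛ-self ⊨T (γ ,, _) (γ ,, _) (r , related (k , ≈-refl) (l , ≈-refl) (agree a kk≈kl)))

  ⊨-lam : ∀ {a i j U U' T t t'} → Γ ⊨ U ≡ U' ∶ sort i → (Γ ▷ (a , U)) ⊨ t ≡ t' ∶ T →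
    Γ ⊨ lam a U t ≡ lam a U' t' ∶ pi a i j U T
  ≈ᵛ (⊨-lam {a} {t = t} {t'} ⊨U ⊨t) γ γ' r =
    Lam-cong (λ v → ⟦ t ⟧ (γ ,, v)) (λ v → ⟦ t' ⟧ (γ' ,, v)) (≈ᵛ ⊨U γ γ' r)
      (λ k l kk≈kl → ≈ᵛ ⊨t (γ ,, _) (γ' ,, _) (EnvRel-▷ ⊨U r k l (agree a kk≈kl)))
  ∈ᵛ (⊨-lam {a} {U = U} {T = T} {t} ⊨U ⊨t) γ r =
    Lam-∈-Pi a (⟦ U ⟧ γ) (λ v → ⟦ t ⟧ (γ ,, v)) (⟦ T ⟧⁺ γ (⟦ U ⟧ γ))
      (λ k → ∈ᵛ ⊨t (γ ,, _) (r , related (k , ≈-refl) (k , ≈-refl) (agree a ≈-refl)))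
      (λ k l agr → ≈ᵛ-self ⊨t (γ ,, _) (γ ,, _) (r , related (k , ≈-refl) (l , ≈-refl) agr))

  ⊨-app : ∀ {a i j U T t t' u u'} → Γ ⊨ t ≡ t' ∶ pi a i j U T → Γ ⊨ u ≡ u' ∷[ a ] U →
    Γ ⊨ app a t u ≡ app a t' u' ∶ (T [ u ])
  ≈ᵛ (⊨-app {a} {U = U} {T} ⊨t ⊨u) γ γ' r =
    ·-cong-Pi a (⟦ U ⟧ γ) (⟦ T ⟧⁺ γ (⟦ U ⟧ γ)) (⟦ U ⟧ γ') (⟦ T ⟧⁺ γ' (⟦ U ⟧ γ'))
      (∈ᵛ ⊨t γ (EnvRel-reflˡ Γ r)) (∈ᵛʳ ⊨t γ' (EnvRel-reflʳ Γ r)) (≈ᵛ ⊨t γ γ' r) (argᵛ ⊨u γ γ' r)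
  ∈ᵛ (⊨-app {a} {U = U} {T} {u = u} ⊨t ⊨u) γ r =
    let (k , kk≈u , tu∈) = ·-∈-Pi a (⟦ U ⟧ γ) (⟦ T ⟧⁺ γ (⟦ U ⟧ γ)) (∈ᵛ ⊨t γ r) (∈ˡ (argᵛ ⊨u γ γ r))
    in ∈-respʳ-≈ (≈-trans (⟦⟧-cong₀ T kk≈u) (≈-sym (⟦[]⟧ T u))) tu∈

  ⊨-conv : ∀ {t t' T T' k} → Γ ⊨ t ≡ t' ∶ T → Γ ⊨ T ≡ T' ∶ sort k → Γ ⊨ t ≡ t' ∶ T'
  ≈ᵛ (⊨-conv ⊨t _)   = ≈ᵛ ⊨t
  ∈ᵛ (⊨-conv ⊨t ⊨T) γ r = ∈-respʳ-≈ (≈ᵛ ⊨T γ γ r) (∈ᵛ ⊨t γ r)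

  ⊨-sym : ∀ {t t' T} → Γ ⊨ t ≡ t' ∶ T → Γ ⊨ t' ≡ t ∶ T
  ≈ᵛ (⊨-sym ⊨t) γ γ' r = ≈-sym (≈ᵛ ⊨t γ' γ (EnvRel-sym Γ r))
  ∈ᵛ (⊨-sym ⊨t)        = ∈ᵛʳ ⊨t

  ⊨-trans : ∀ {t t' t'' T} → Γ ⊨ t ≡ t' ∶ T → Γ ⊨ t' ≡ t'' ∶ T → Γ ⊨ t ≡ t'' ∶ T
  ≈ᵛ (⊨-trans ⊨t ⊨t') γ γ' r = ≈-trans (≈ᵛ ⊨t γ γ' r) (≈ᵛ ⊨t' γ' γ' (EnvRel-reflʳ Γ r))
  ∈ᵛ (⊨-trans ⊨t _)         = ∈ᵛ ⊨t

  ⊨-β : ∀ {a U T t u} → (Γ ▷ (a , U)) ⊨ t ≡ t ∶ T → Γ ⊨ u ≡ u ∷[ a ] U →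
    Γ ⊨ app a (lam a U t) u ≡ t [ u ] ∶ (T [ u ])
  ≈ᵛ (⊨-β {a} {U} {t = t} {u} ⊨t ⊨u) γ γ' r = begin
    ⟦ app a (lam a U t) u ⟧ γ  ≈⟨ Lam-β (λ v → ⟦ t ⟧ (γ ,, v)) (⟦⟧-cong₀ t) (∈ˡ (argᵛ ⊨u γ γ' r)) ⟩
    ⟦ t ⟧ (γ ,, ⟦ u ⟧ γ)       ≈⟨ ≈ᵛ ⊨t (γ ,, ⟦ u ⟧ γ) (γ' ,, ⟦ u ⟧ γ') (r , argᵛ ⊨u γ γ' r) ⟩
    ⟦ t ⟧ (γ' ,, ⟦ u ⟧ γ')     ≈⟨ ≈-sym (⟦[]⟧ t u) ⟩
    ⟦ t [ u ] ⟧ γ'             ∎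
  ∈ᵛ (⊨-β {T = T} {t} {u} ⊨t ⊨u) γ r =
    ∈-respˡ-≈ (≈-sym (Lam-β (λ v → ⟦ t ⟧ (γ ,, v)) (⟦⟧-cong₀ t) (∈ˡ (argᵛ ⊨u γ γ r))))
      (∈-respʳ-≈ (≈-sym (⟦[]⟧ T u)) (∈ᵛ ⊨t (γ ,, ⟦ u ⟧ γ) (r , argᵛ ⊨u γ γ r)))

  ⊨-η : ∀ {a i j U T t} → Γ ⊨ t ≡ t ∶ pi a i j U T →
    Γ ⊨ t ≡ lam a U (app a (wk t) (var zero)) ∶ pi a i j U T
  ≈ᵛ (⊨-η {a} {U = U} {T} {t} ⊨t) γ γ' r = begin
    ⟦ t ⟧ γ                                  ≈⟨ ≈ᵛ ⊨t γ γ' r ⟩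
    ⟦ t ⟧ γ'                                 ≈⟨ Pi-η a (⟦ U ⟧ γ') (⟦ T ⟧⁺ γ' (⟦ U ⟧ γ'))
                                                  (∈ᵛ ⊨t γ' (EnvRel-reflʳ Γ r)) ⟩
    Lam (⟦ U ⟧ γ') (⟦ t ⟧ γ' ·_)             ≈⟨ Lam-cong {⟦ U ⟧ γ'} (⟦ t ⟧ γ' ·_) (λ v → ⟦ wk t ⟧ (γ' ,, v) · v)
                                                  ≈-refl
                                                  (λ _ _ v≈w → ·-cong (≈-sym (⟦wk⟧ t)) v≈w) ⟩
    ⟦ lam a U (app a (wk t) (var zero)) ⟧ γ' ∎
  ∈ᵛ (⊨-η ⊨t) = ∈ᵛ ⊨t

  ⊨-rel : ∀ {u u' U} → Γ ⊨ u ≡ u' ∶ U → Γ ⊨ u ≡ u' ∷[ rel ] U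
  argᵛ (⊨-rel ⊨u) γ γ' r =
    related (∈ᵛ ⊨u γ (EnvRel-reflˡ Γ r)) (∈ᵛʳ ⊨u γ' (EnvRel-reflʳ Γ r)) (≈ᵛ ⊨u γ γ' r)

  ⊨-irr : ∀ {u u' U} → (Γ ⊕) ⊨ u ≡ u ∶ U → (Γ ⊕) ⊨ u' ≡ u' ∶ U → Γ ⊨ u ≡ u' ∷[ irr ] U
  argᵛ (⊨-irr ⊨u ⊨u') γ γ' r =
    related (∈ᵛ ⊨u γ (EnvRel-⊕ Γ (EnvRel-reflˡ Γ r))) (∈ᵛ ⊨u' γ' (EnvRel-⊕ Γ (EnvRel-reflʳ Γ r))) tt

mutual
  sound : ∀ {n} {Γ : Ctx n} {t T} → Γ ⊢ t ∶ T → Γ ⊨ t ≡ t ∶ T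
  sound (t-sort _)          = ⊨-sort
  sound (t-pi ⊢U ⊢T)        = ⊨-pi (sound ⊢U) (sound ⊢T)
  sound (t-var _ x∈Γ)       = ⊨-var x∈Γ
  sound (t-lam ⊢t (_ , ⊢Π)) = ⊨-lam (sound-domain ⊢Π) (sound ⊢t)
  sound (t-app ⊢t ⊢u)       = ⊨-app (sound ⊢t) (sound-arg ⊢u)
  sound (t-conv ⊢t (_ , T≡T')) = ⊨-conv (sound ⊢t) (sound-eq T≡T')

  sound-domain : ∀ {n} {Γ : Ctx n} {a i j U T S} → Γ ⊢ pi a i j U T ∶ S → Γ ⊨ U ≡ U ∶ sort i
  sound-domain (t-pi ⊢U _)   = sound ⊢U
  sound-domain (t-conv ⊢Π _) = sound-domain ⊢Π

  sound-arg : ∀ {n} {Γ : Ctx n} {u a U} → Γ ⊢ u ∷[ a ] U → Γ ⊨ u ≡ u ∷[ a ] U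
  sound-arg (∷rel ⊢u) = ⊨-rel (sound ⊢u)
  sound-arg (∷irr ⊢u) = ⊨-irr (sound ⊢u) (sound ⊢u)

  sound-arg-eq : ∀ {n} {Γ : Ctx n} {u u' a U} → Γ ⊢ u ≡ u' ∷[ a ] U → Γ ⊨ u ≡ u' ∷[ a ] U
  sound-arg-eq (≡rel u≡u')    = ⊨-rel (sound-eq u≡u')
  sound-arg-eq (≡irr ⊢u ⊢u') = ⊨-irr (sound ⊢u) (sound ⊢u')

  sound-eq : ∀ {n} {Γ : Ctx n} {t t' T} → Γ ⊢ t ≡ t' ∶ T → Γ ⊨ t ≡ t' ∶ T
  sound-eq (e-β ⊢t ⊢u)               = ⊨-β (sound ⊢t) (sound-arg ⊢u)
  sound-eq (e-η ⊢t)                  = ⊨-η (sound ⊢t)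
  sound-eq (e-refl ⊢t)               = sound ⊢t
  sound-eq (e-sym t≡t')              = ⊨-sym (sound-eq t≡t')
  sound-eq (e-trans t≡t' t'≡t'')     = ⊨-trans (sound-eq t≡t') (sound-eq t'≡t'')
  sound-eq (e-pi U≡U' T≡T')          = ⊨-pi (sound-eq U≡U') (sound-eq T≡T')
  sound-eq (e-lam U≡U' _ t≡t')       = ⊨-lam (sound-eq U≡U') (sound-eq t≡t')
  sound-eq (e-app t≡t' u≡u')         = ⊨-app (sound-eq t≡t') (sound-arg-eq u≡u')
  sound-eq (e-conv t≡t' (_ , T≡T'))  = ⊨-conv (sound-eq t≡t') (sound-eq T≡T')

theorem5p11 : ¬ Σ (Tm 1) (λ t → X∶Set₀ ⊢ t ∶ var zero)
theorem5p11 (t , ⊢t) = index (∈ᵛ (sound ⊢t) γ (tt , related X∈Set₀ X∈Set₀ ≈-refl))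
  where
  γ : Env 1
  γ _ = Lvl.El 0 (Lvl.univ {0})

  X∈Set₀ : γ zero ∈ Sort 0
  X∈Set₀ = Lvl.univ {0} , ≈-refl
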